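{- Let $p$ be an even positive integer, $\mu=\frac{p^2}{4}+2p+2$, $\gamma=2\mu-\left(\frac{p}{2}+4\right)$ and $S=S(p)=\langle \mu,\gamma,\gamma+1\rangle_{p\mu}$. Then the number of decomposable elements of $S$ at level $q$ is $$|D_q(S)|=\frac{p^2}{8}+\frac{5}{4}p+3.$$
   Context: A numerical semigroup is a submonoid of $(\mathbb N,+)$ with finite complement. For integers $a_1,\dots,a_r$ and $t$, $\langle a_1,\dots,a_r\rangle_t$ denotes the smallest numerical semigroup containing $a_1,\dots,a_r$ and all integers $\ge t$. For a numerical semigroup $S$ with conductor $c$ (smallest integer such that all integers $\ge c$ are in $S$) and multiplicity $m$ (least positive element), let $P(S)$ be the set of minimal generators, $I_q=\{z\in\mathbb Z: c\le z<c+m\}$, and $D_q(S)=I_q\setminus P(S)$. -}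

module Defs where

open import Data.Nat using (ℕ; zero; suc; _+_; _*_; _∸_; _≤_; _<_)
open import Data.Nat.DivMod using (_/_)
open import Data.List using (List; []; _∷_; length)
open import Data.List.Membership.Propositional using (_∈_)
open import Data.List.Relation.Unary.Unique.Propositional using (Unique)
open import Data.Product using (Σ; _×_; ∃-syntax)
open import Relation.Nullary using (¬_)
open import Relation.Binary.PropositionalEquality using (_≡_)
open import Function.Bundles using (_⇔_)

-- ⟨ gens ⟩_t : the smallest submonoid of (ℕ,+) containing the elements of
-- gens and all integers ≥ t (inductively generated, hence the smallest).
data Gen (gens : List ℕ) (t : ℕ) : ℕ → Set where
  zero∈ : Gen gens t 0
  gen∈  : ∀ {a} → a ∈ gens → Gen gens t a
  big∈  : ∀ {x} → t ≤ x → Gen gens t x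
  add∈  : ∀ {x y} → Gen gens t x → Gen gens t y → Gen gens t (x + y)

IsConductor : (ℕ → Set) → ℕ → Set
IsConductor S c = (∀ z → c ≤ z → S z) × (∀ c′ → (∀ z → c′ ≤ z → S z) → c ≤ c′)

IsMultiplicity : (ℕ → Set) → ℕ → Set
IsMultiplicity S m = (0 < m) × S m × (∀ x → 0 < x → S x → m ≤ x)

MinGen : (ℕ → Set) → ℕ → Set
MinGen S x = S x × (0 < x) ×
  (¬ (∃[ y ] ∃[ z ] (0 < y × 0 < z × S y × S z × y + z ≡ x)))

-- D_q(S) = I_q \ P(S), I_q = [c, c+m)
InDq : (ℕ → Set) → ℕ → ℕ → ℕ → Set
InDq S c m z = (c ≤ z) × (z < c + m) × ¬ MinGen S z

HasCard : (ℕ → Set) → ℕ → Set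
HasCard P n = Σ (List ℕ) λ l → Unique l × (∀ z → (z ∈ l) ⇔ P z) × length l ≡ n

μ : ℕ → ℕ
μ p = p * p / 4 + 2 * p + 2

γ : ℕ → ℕ
γ p = 2 * μ p ∸ (p / 2 + 4)

S : ℕ → ℕ → Set
S p = Gen (μ p ∷ γ p ∷ suc (γ p) ∷ []) (p * μ p)

-- Write p = 2K and h = K + 4, so that μ = K h + 2, γ = 2μ − h and t = pμ.  An element of
-- ⟨μ, γ, γ + 1⟩ is a μ + s γ + e with e ≤ s, i.e. (a + 2s) μ + e − s h.  For 0 ≤ y < μ,
-- comparing remainders modulo μ (when s ≤ K) or sizes (when s > K) shows that t + y lies in
-- ⟨μ, γ, γ + 1⟩ exactly when y = 0, y = (K − s) h + 2 + e with 1 ≤ s ≤ K and e ≤ s, or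
-- y = K (K + 3) + e with e ≤ K + 1.  The same comparison shows t − 1 ∉ S, so t is the
-- conductor, and μ ≤ γ makes μ the multiplicity.  An element of [t, t + μ) is decomposable in S
-- exactly when it lies in ⟨μ, γ, γ + 1⟩, since in a decomposition into nonzero elements of S
-- both summands lie below t.  Hence |D_q(S)| = 1 + Σ_{s=1}^{K} (s + 1) + (K + 2).

module Submission where

open import Data.Nat
open import Data.Nat.Properties
open import Data.Nat.DivMod using (_%_; _/_; [m+kn]%n≡m%n; m<n⇒m%n≡m; m*n/n≡m)
open import Data.Nat.Divisibility using (_∣_; divides)
open import Data.Nat.Tactic.RingSolver using (solve-∀)
open import Data.Empty using (⊥; ⊥-elim)
open import Data.Product using (_×_; _,_; proj₁; proj₂; ∃-syntax)
open import Data.Sum using (_⊎_; inj₁; inj₂)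
open import Data.List using (List; []; _∷_; _++_; map; applyUpTo)
open import Data.List.Properties using (length-++; length-map; length-applyUpTo)
open import Data.List.Membership.Propositional using (_∈_)
open import Data.List.Membership.Propositional.Properties
  using (∈-++⁺ˡ; ∈-++⁺ʳ; ∈-++⁻; ∈-map⁺; ∈-map⁻; ∈-applyUpTo⁺; ∈-applyUpTo⁻)
open import Data.List.Membership.DecPropositional _≟_ using (_∈?_)
open import Data.List.Relation.Unary.Any using (here; there)
open import Data.List.Relation.Unary.All using ([])
open import Data.List.Relation.Unary.AllPairs using ([]; _∷_)
import Data.List.Relation.Unary.Unique.Propositional.Properties as Unique
open import Function using (_∘′_)
open import Function.Bundles using (_⇔_; mk⇔; Equivalence)
open import Function.Properties.Equivalence using () renaming (sym to ⇔-sym)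
open import Relation.Nullary using (¬_; Dec; yes; no)
open import Relation.Nullary.Decidable using (map′)
open import Relation.Binary.PropositionalEquality
open import Defs

open Equivalence using (to; from)

Interval : ℕ → ℕ → ℕ → Set
Interval lo n y = ∃[ e ] (e < n × y ≡ lo + e)

HasCard-resp : ∀ {P Q : ℕ → Set} {n} → (∀ z → P z ⇔ Q z) → HasCard P n → HasCard Q n
HasCard-resp P⇔Q (l , unique , l⇔P , len) =
  l , unique , (λ z → mk⇔ (to (P⇔Q z) ∘′ to (l⇔P z)) (from (l⇔P z) ∘′ from (P⇔Q z))) , len

HasCard-none : ∀ {P : ℕ → Set} → (∀ z → ¬ P z) → HasCard P 0
HasCard-none ∄P = [] , [] , (λ z → mk⇔ (λ ()) (⊥-elim ∘′ ∄P z)) , refl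

HasCard-singleton : ∀ a → HasCard (_≡ a) 1
HasCard-singleton a =
  a ∷ [] , [] ∷ [] , (λ z → mk⇔ (λ { (here z≡a) → z≡a ; (there ()) }) here) , refl

HasCard-Interval : ∀ lo n → HasCard (Interval lo n) n
HasCard-Interval lo n =
  applyUpTo (lo +_) n ,
  Unique.applyUpTo⁺₁ (lo +_) n (λ i<j _ eq → <⇒≢ i<j (+-cancelˡ-≡ lo _ _ eq)) ,
  (λ z → mk⇔ (∈-applyUpTo⁻ (lo +_)) λ { (e , e<n , refl) → ∈-applyUpTo⁺ (lo +_) e<n }) ,
  length-applyUpTo (lo +_) n

HasCard-⊎ : ∀ {P Q : ℕ → Set} {m n} → HasCard P m → HasCard Q n →
            (∀ {y z} → P y → Q z → y < z) → HasCard (λ z → P z ⊎ Q z) (m + n)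
HasCard-⊎ {P} {Q} (k , unique-k , k⇔P , refl) (l , unique-l , l⇔Q , refl) P<Q =
  k ++ l ,
  Unique.++⁺ unique-k unique-l
    (λ (z∈k , z∈l) → <-irrefl refl (P<Q (to (k⇔P _) z∈k) (to (l⇔Q _) z∈l))) ,
  (λ z → mk⇔ (from-list z) (to-list z)) ,
  length-++ k
  where
  from-list : ∀ z → z ∈ k ++ l → P z ⊎ Q z
  from-list z z∈ with ∈-++⁻ k z∈
  ... | inj₁ z∈k = inj₁ (to (k⇔P z) z∈k)
  ... | inj₂ z∈l = inj₂ (to (l⇔Q z) z∈l)
  to-list : ∀ z → P z ⊎ Q z → z ∈ k ++ l
  to-list z (inj₁ Pz) = ∈-++⁺ˡ (from (k⇔P z) Pz)
  to-list z (inj₂ Qz) = ∈-++⁺ʳ k (from (l⇔Q z) Qz)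

HasCard-shift : ∀ {P Q : ℕ → Set} {n} t → HasCard P n →
                (∀ z → Q z → t ≤ z) → (∀ y → Q (t + y) ⇔ P y) → HasCard Q n
HasCard-shift {P} {Q} t (l , unique , l⇔P , refl) t≤Q Q⇔P =
  map (t +_) l ,
  Unique.map⁺ (+-cancelˡ-≡ t _ _) unique ,
  (λ z → mk⇔ (from-list z) (to-list z)) ,
  length-map (t +_) l
  where
  from-list : ∀ z → z ∈ map (t +_) l → Q z
  from-list z z∈ with ∈-map⁻ (t +_) z∈
  ... | y , y∈l , refl = from (Q⇔P y) (to (l⇔P y) y∈l)
  to-list : ∀ z → Q z → z ∈ map (t +_) l
  to-list z Qz with m≤n⇒∃[o]m+o≡n (t≤Q z Qz)
  ... | y , refl = ∈-map⁺ (t +_) (from (l⇔P y) (to (Q⇔P y) Qz))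

HasCard⇒Dec : ∀ {P : ℕ → Set} {n} → HasCard P n → ∀ z → Dec (P z)
HasCard⇒Dec (l , _ , l⇔P , _) z = map′ (to (l⇔P z)) (from (l⇔P z)) (z ∈? l)

-- Step r < n of the staircase is the block [lo + r h, lo + r h + s], where s = n − r.
Stair : ℕ → ℕ → ℕ → ℕ → Set
Stair h lo n y = ∃[ r ] ∃[ s ] ∃[ e ] (s + r ≡ n × 0 < s × e ≤ s × y ≡ lo + r * h + e)

Stair-zero : ∀ {h lo y} → ¬ Stair h lo 0 y
Stair-zero (_ , suc _ , _ , () , _)

Stair-suc : ∀ h lo n y → Stair h lo (suc n) y ⇔ (Interval lo (2 + n) y ⊎ Stair h (lo + h) n y)
Stair-suc h lo n y = mk⇔ split join
  where
  split : Stair h lo (suc n) y → Interval lo (2 + n) y ⊎ Stair h (lo + h) n y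
  split (zero , s , e , s+0≡1+n , _ , e≤s , refl) =
    inj₁ (e , s≤s (subst (e ≤_) (trans (sym (+-identityʳ s)) s+0≡1+n) e≤s) ,
          cong (_+ e) (+-identityʳ lo))
  split (suc r , s , e , s+1+r≡1+n , 0<s , e≤s , refl) =
    inj₂ (r , s , e , suc-injective (trans (sym (+-suc s r)) s+1+r≡1+n) , 0<s , e≤s ,
          cong (_+ e) (sym (+-assoc lo h (r * h))))
  join : Interval lo (2 + n) y ⊎ Stair h (lo + h) n y → Stair h lo (suc n) y
  join (inj₁ (e , s≤s e≤1+n , refl)) =
    zero , suc n , e , +-identityʳ (suc n) , s≤s z≤n , e≤1+n , cong (_+ e) (sym (+-identityʳ lo))
  join (inj₂ (r , s , e , refl , 0<s , e≤s , refl)) =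
    suc r , s , e , +-suc s r , 0<s , e≤s , cong (_+ e) (+-assoc lo h (r * h))

Stair-≥ : ∀ {h lo n y} → Stair h lo n y → lo ≤ y
Stair-≥ {h} {lo} (r , _ , e , _ , _ , _ , refl) = ≤-trans (m≤m+n lo (r * h)) (m≤m+n _ e)

-- The last step has only two elements, hence the + 2.
Stair-< : ∀ {h lo n y} .{{_ : NonZero h}} → Stair h lo (suc n) y → y < lo + n * h + 2
Stair-< {h} {lo} (r , suc s , e , refl , _ , e≤1+s , refl) = begin-strict
  lo + r * h + e           ≤⟨ +-monoʳ-≤ (lo + r * h) e≤1+s ⟩
  lo + r * h + suc s       ≤⟨ +-monoʳ-≤ (lo + r * h) (s≤s (m≤m*n s h)) ⟩
  lo + r * h + suc (s * h) <⟨ +-monoʳ-< (lo + r * h) (n<1+n _) ⟩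
  lo + r * h + (2 + s * h) ≡⟨ regroup lo r s h ⟩
  lo + (s + r) * h + 2     ∎
  where
  open ≤-Reasoning
  regroup : ∀ lo r s h → lo + r * h + (2 + s * h) ≡ lo + (s + r) * h + 2
  regroup = solve-∀

Stair-card : ∀ h lo n → n < h → ∃[ c ] (HasCard (Stair h lo n) c × 2 * c ≡ n * (n + 3))
Stair-card h lo zero _ = 0 , HasCard-none (λ _ → Stair-zero) , refl
Stair-card h lo (suc n) 1+n<h with Stair-card h (lo + h) n (<-trans (n<1+n n) 1+n<h)
... | c , higher-steps , 2c≡ =
  2 + n + c ,
  HasCard-resp (λ y → ⇔-sym (Stair-suc h lo n y))
    (HasCard-⊎ (HasCard-Interval lo (2 + n)) higher-steps first<higher) ,
  count
  where
  first<higher : ∀ {y z} → Interval lo (2 + n) y → Stair h (lo + h) n z → y < z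
  first<higher (e , e<2+n , refl) stair =
    <-≤-trans (+-monoʳ-< lo (<-≤-trans e<2+n 1+n<h)) (Stair-≥ stair)
  count : 2 * (2 + n + c) ≡ suc n * (suc n + 3)
  count = begin
    2 * (2 + n + c)           ≡⟨ *-distribˡ-+ 2 (2 + n) c ⟩
    2 * (2 + n) + 2 * c       ≡⟨ cong (2 * (2 + n) +_) 2c≡ ⟩
    2 * (2 + n) + n * (n + 3) ≡⟨ triangle n ⟩
    suc n * (suc n + 3)       ∎
    where
    open ≡-Reasoning
    triangle : ∀ n → 2 * (2 + n) + n * (n + 3) ≡ suc n * (suc n + 3)
    triangle = solve-∀

-- ⟨m, g, g + 1⟩: a m + b g + e (g + 1) is written a m + s g + e with s = b + e.
Generated : ℕ → ℕ → ℕ → Set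
Generated m g x = ∃[ a ] ∃[ s ] ∃[ e ] (e ≤ s × x ≡ a * m + s * g + e)

Generated-+ : ∀ {m g x y} → Generated m g x → Generated m g y → Generated m g (x + y)
Generated-+ {m} {g} (a , s , e , e≤s , refl) (a′ , s′ , e′ , e′≤s′ , refl) =
  a + a′ , s + s′ , e + e′ , +-mono-≤ e≤s e′≤s′ , regroup m g a s e a′ s′ e′
  where
  regroup : ∀ m g a s e a′ s′ e′ →
    a * m + s * g + e + (a′ * m + s′ * g + e′) ≡ (a + a′) * m + (s + s′) * g + (e + e′)
  regroup = solve-∀

Gen⇒Generated : ∀ {m g t x} → Gen (m ∷ g ∷ suc g ∷ []) t x → t ≤ x ⊎ Generated m g x
Gen⇒Generated zero∈ = inj₂ (0 , 0 , 0 , z≤n , refl)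
Gen⇒Generated {m} {g} (gen∈ (here refl)) = inj₂ (1 , 0 , 0 , z≤n , as-m m g)
  where
  as-m : ∀ m g → m ≡ 1 * m + 0 * g + 0
  as-m = solve-∀
Gen⇒Generated {m} {g} (gen∈ (there (here refl))) = inj₂ (0 , 1 , 0 , z≤n , as-g m g)
  where
  as-g : ∀ m g → g ≡ 0 * m + 1 * g + 0
  as-g = solve-∀
Gen⇒Generated {m} {g} (gen∈ (there (there (here refl)))) = inj₂ (0 , 1 , 1 , s≤s z≤n , as-g+1 m g)
  where
  as-g+1 : ∀ m g → suc g ≡ 0 * m + 1 * g + 1
  as-g+1 = solve-∀
Gen⇒Generated (big∈ t≤x) = inj₁ t≤x
Gen⇒Generated (add∈ {x} {y} Sx Sy) with Gen⇒Generated Sx | Gen⇒Generated Sy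
... | inj₁ t≤x | _        = inj₁ (≤-trans t≤x (m≤m+n x y))
... | inj₂ _   | inj₁ t≤y = inj₁ (≤-trans t≤y (m≤n+m y x))
... | inj₂ Gx  | inj₂ Gy  = inj₂ (Generated-+ Gx Gy)

Generated⇒Gen : ∀ {m g t x} → Generated m g x → Gen (m ∷ g ∷ suc g ∷ []) t x
Generated⇒Gen {m} {g} (a , s , e , e≤s , refl) with m≤n⇒∃[o]m+o≡n e≤s
... | b , refl = subst (Gen _ _) (regroup m g a e b)
  (add∈ (add∈ (multiple (here refl) a) (multiple (there (here refl)) b))
        (multiple (there (there (here refl))) e))
  where
  multiple : ∀ {t x} → x ∈ m ∷ g ∷ suc g ∷ [] → ∀ n → Gen (m ∷ g ∷ suc g ∷ []) t (n * x)
  multiple x∈ zero    = zero∈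
  multiple x∈ (suc n) = add∈ (gen∈ x∈) (multiple x∈ n)
  regroup : ∀ m g a e b → a * m + b * g + e * suc g ≡ a * m + (e + b) * g + e
  regroup = solve-∀

Generated-≥ : ∀ {m g x} → m ≤ g → 0 < x → Generated m g x → m ≤ x
Generated-≥ {m} {g} _ _ (suc a , s , e , _ , refl) =
  ≤-trans (m≤m+n m (a * m)) (≤-trans (m≤m+n _ (s * g)) (m≤m+n _ e))
Generated-≥ {m} {g} m≤g _ (zero , suc s , e , _ , refl) =
  ≤-trans m≤g (≤-trans (m≤m+n g (s * g)) (m≤m+n _ e))
Generated-≥ _ () (zero , zero , zero , z≤n , refl)

-- Above g + 1, a generated element is a generator plus a nonzero generated element.
Generated-¬MinGen : ∀ {m g t x} → 0 < m → m ≤ g → suc g < x → Generated m g x →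
                    ¬ MinGen (Gen (m ∷ g ∷ suc g ∷ []) t) x
Generated-¬MinGen {m} {g} {t} {x} 0<m m≤g 1+g<x (a , s , e , e≤s , x≡) (_ , _ , indecomposable) =
  indecomposable (split a s e e≤s x≡)
  where
  gens : List ℕ
  gens = m ∷ g ∷ suc g ∷ []
  Split : Set
  Split = ∃[ y ] ∃[ z ] (0 < y × 0 < z × Gen gens t y × Gen gens t z × y + z ≡ x)
  peel : ∀ {y z} → y ∈ gens → 0 < y → y ≤ suc g → Generated m g z → y + z ≡ x → Split
  peel {y} {zero} _ _ y≤1+g _ y+0≡x =
    ⊥-elim (<⇒≱ 1+g<x (≤-trans (≤-reflexive (trans (sym y+0≡x) (+-identityʳ y))) y≤1+g))
  peel {y} {suc z} y∈ 0<y _ Gz y+z≡x =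
    y , suc z , 0<y , s≤s z≤n , gen∈ y∈ , Generated⇒Gen Gz , y+z≡x
  split : ∀ a s e → e ≤ s → x ≡ a * m + s * g + e → Split
  split (suc a) s e e≤s refl =
    peel (here refl) 0<m (≤-trans m≤g (n≤1+n g)) (a , s , e , e≤s , refl) (regroup m g a s e)
    where
    regroup : ∀ m g a s e → m + (a * m + s * g + e) ≡ suc a * m + s * g + e
    regroup = solve-∀
  split zero (suc s) zero _ refl =
    peel (there (here refl)) (≤-trans 0<m m≤g) (n≤1+n g) (0 , s , 0 , z≤n , refl) (regroup m g s)
    where
    regroup : ∀ m g s → g + (0 * m + s * g + 0) ≡ 0 * m + suc s * g + 0
    regroup = solve-∀
  split zero (suc s) (suc e) (s≤s e≤s) refl =
    peel (there (there (here refl))) (s≤s z≤n) ≤-refl (0 , s , e , e≤s , refl) (regroup m g s e)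
    where
    regroup : ∀ m g s e → suc g + (0 * m + s * g + e) ≡ 0 * m + suc s * g + suc e
    regroup = solve-∀
  split zero zero zero _ refl = ⊥-elim (<⇒≱ 1+g<x z≤n)

Generated-level : ∀ {m g h x} a s e → g + h ≡ 2 * m → x ≡ a * m + s * g + e →
                  x + s * h ≡ (a + 2 * s) * m + e
Generated-level {m} {g} {h} a s e g+h≡2m refl = begin
  a * m + s * g + e + s * h ≡⟨ regroup a s e m g h ⟩
  a * m + s * (g + h) + e   ≡⟨ cong (λ u → a * m + s * u + e) g+h≡2m ⟩
  a * m + s * (2 * m) + e   ≡⟨ collect a s e m ⟩
  (a + 2 * s) * m + e       ∎
  where
  open ≡-Reasoning
  regroup : ∀ a s e m g h → a * m + s * g + e + s * h ≡ a * m + s * (g + h) + e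
  regroup = solve-∀
  collect : ∀ a s e m → a * m + s * (2 * m) + e ≡ (a + 2 * s) * m + e
  collect = solve-∀

remainder-unique : ∀ {m} .{{_ : NonZero m}} a b {r r′} →
                   a * m + r ≡ b * m + r′ → r < m → r′ < m → r ≡ r′
remainder-unique {m} a b {r} {r′} eq r<m r′<m = begin
  r                ≡⟨ m<n⇒m%n≡m r<m ⟨
  r % m            ≡⟨ [m+kn]%n≡m%n r a m ⟨
  (r + a * m) % m  ≡⟨ cong (_% m) (trans (+-comm r (a * m)) (trans eq (+-comm (b * m) r′))) ⟩
  (r′ + b * m) % m ≡⟨ [m+kn]%n≡m%n r′ b m ⟩
  r′ % m           ≡⟨ m<n⇒m%n≡m r′<m ⟩
  r′               ∎
  where open ≡-Reasoning

IsConductor-unique : ∀ {P : ℕ → Set} {c t} → IsConductor P c →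
                     (∀ z → t ≤ z → P z) → (∀ x → suc x ≡ t → ¬ P x) → c ≡ t
IsConductor-unique {P} {c} {t} (c-conductor , c-least) t-conductor t-1∉P =
  ≤-antisym (c-least t t-conductor) t≤c
  where
  t≤c : t ≤ c
  t≤c with ≤-<-connex t c
  ... | inj₁ t≤c = t≤c
  ... | inj₂ c<t with m≤n⇒∃[o]m+o≡n c<t
  ...   | o , 1+c+o≡t = ⊥-elim (t-1∉P (c + o) 1+c+o≡t (c-conductor (c + o) (m≤m+n c o)))

IsMultiplicity-unique : ∀ {P : ℕ → Set} {m μ} → IsMultiplicity P m →
                        0 < μ → P μ → (∀ x → 0 < x → P x → μ ≤ x) → m ≡ μ
IsMultiplicity-unique (0<m , Pm , m-least) 0<μ Pμ μ-least =
  ≤-antisym (m-least _ 0<μ Pμ) (μ-least _ 0<m Pm)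

-- For p = 2K: μK K = μ p, γK K = γ p = 2 μK K − (4 + K) and tK K = p μ p (see S≡SK).
μK γK tK : ℕ → ℕ
μK K = 2 + K * (4 + K)
γK K = K * (2 * K + 7)
tK K = K * 2 * μK K

SK : ℕ → ℕ → Set
SK K = Gen (μK K ∷ γK K ∷ suc (γK K) ∷ []) (tK K)

-- The y with tK K + y ∈ D_q; the staircase is y = (K − s) (4 + K) + 2 + e, 1 ≤ s ≤ K, e ≤ s.
Offsets : ℕ → ℕ → Set
Offsets K y = y ≡ 0 ⊎ Stair (4 + K) 2 K y ⊎ Interval (K * (3 + K)) (2 + K) y

γK+[4+K]≡2*μK : ∀ K → γK K + (4 + K) ≡ 2 * μK K
γK+[4+K]≡2*μK = identity
  where
  identity : ∀ K → K * (2 * K + 7) + (4 + K) ≡ 2 * (2 + K * (4 + K))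
  identity = solve-∀

[1+K]*γK≡tK+K*[3+K] : ∀ K → suc K * γK K ≡ tK K + K * (3 + K)
[1+K]*γK≡tK+K*[3+K] = identity
  where
  identity : ∀ K → suc K * (K * (2 * K + 7)) ≡ K * 2 * (2 + K * (4 + K)) + K * (3 + K)
  identity = solve-∀

s*[4+K]<μK : ∀ s r → s * (4 + (s + r)) < μK (s + r)
s*[4+K]<μK s r = s≤s (≤-trans (*-monoˡ-≤ (4 + (s + r)) (m≤m+n s r)) (n≤1+n _))

s*[4+k]≤1+s⇒s≡0 : ∀ k s → s * (4 + k) ≤ suc s → s ≡ 0
s*[4+k]≤1+s⇒s≡0 k zero    _ = refl
s*[4+k]≤1+s⇒s≡0 k (suc s) s*[4+k]≤1+s =
  ⊥-elim (<⇒≱ (+-mono-≤ (≤-trans (m≤m+n 3 k) (n≤1+n _)) (m≤m*n s (4 + k))) s*[4+k]≤1+s)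

1+K<μK : ∀ K → suc K < μK K
1+K<μK K = s≤s (s≤s (m≤m*n K (4 + K)))

μK≤γK : ∀ {K} → 0 < K → μK K ≤ γK K
μK≤γK {suc j} _ = ≤-trans (m≤m+n _ _) (≤-reflexive (sym (identity j)))
  where
  identity : ∀ j → suc j * (2 * suc j + 7) ≡ 2 + suc j * (4 + suc j) + (j * j + 5 * j + 2)
  identity = solve-∀

μK≤tK : ∀ {K} → 0 < K → μK K ≤ tK K
μK≤tK {suc j} _ = m≤n*m (μK (suc j)) (suc j * 2)

2+γK≤tK : ∀ {K} → 0 < K → 2 + γK K ≤ tK K
2+γK≤tK {suc j} _ = ≤-trans (m≤m+n _ _) (≤-reflexive (sym (identity j)))
  where
  identity : ∀ j → suc j * 2 * (2 + suc j * (4 + suc j))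
                 ≡ 2 + suc j * (2 * suc j + 7) + (2 * j * j * j + 12 * j * j + 15 * j + 3)
  identity = solve-∀

-- Modulo μ the equation says y + s h ≡ e.  As y + s h < 2μ, either y + s h = e ≤ s, which
-- forces s = 0 = y, or y + s h = μ + e, a point of the staircase.
offsets-low : ∀ s r a e y → e ≤ s → y < μK (s + r) →
              tK (s + r) + y + s * (4 + (s + r)) ≡ (a + 2 * s) * μK (s + r) + e →
              Offsets (s + r) y
offsets-low zero r a e y e≤0 y<μ eq = inj₁ (begin
  y     ≡⟨ +-identityʳ y ⟨
  y + 0 ≡⟨ remainder-unique (r * 2) (a + 0) divided y+0<μ (≤-trans (s≤s e≤0) (s≤s z≤n)) ⟩
  e     ≡⟨ n≤0⇒n≡0 e≤0 ⟩
  0     ∎)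
  where
  open ≡-Reasoning
  divided : r * 2 * μK r + (y + 0) ≡ (a + 0) * μK r + e
  divided = trans (sym (+-assoc _ y 0)) eq
  y+0<μ : y + 0 < μK r
  y+0<μ = subst (_< μK r) (sym (+-identityʳ y)) y<μ
offsets-low (suc s) r a e y e≤s y<μ eq = by-remainder (y + suc s * h <? μK K)
  where
  K h : ℕ
  K = suc s + r
  h = 4 + K
  divided : K * 2 * μK K + (y + suc s * h) ≡ (a + 2 * suc s) * μK K + e
  divided = trans (sym (+-assoc _ y (suc s * h))) eq
  e<μ : e < μK K
  e<μ = ≤-<-trans e≤s (≤-<-trans (m≤m*n (suc s) h) (s*[4+K]<μK (suc s) r))
  open ≤-Reasoning
  by-remainder : Dec (y + suc s * h < μK K) → Offsets K y
  by-remainder (yes below) with () ← s*[4+k]≤1+s⇒s≡0 K (suc s) (begin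
      suc s * h     ≤⟨ m≤n+m _ y ⟩
      y + suc s * h ≡⟨ remainder-unique (K * 2) (a + 2 * suc s) divided below e<μ ⟩
      e             ≤⟨ e≤s ⟩
      suc s         <⟨ n<1+n (suc s) ⟩
      suc (suc s)   ∎)
  by-remainder (no above) with m≤n⇒∃[o]m+o≡n (≮⇒≥ above)
  ... | w , μ+w≡y+sh = inj₂ (inj₁ (r , suc s , e , refl , s≤s z≤n , e≤s , y≡))
    where
    w<μ : w < μK K
    w<μ = +-cancelˡ-< (μK K) w (μK K)
            (subst (_< μK K + μK K) (sym μ+w≡y+sh) (+-mono-< y<μ (s*[4+K]<μK (suc s) r)))
    w≡e : w ≡ e
    w≡e = remainder-unique (suc (K * 2)) (a + 2 * suc s)
            (trans (regroup (K * 2) (μK K) w) (trans (cong (K * 2 * μK K +_) μ+w≡y+sh) divided))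
            w<μ e<μ
      where
      regroup : ∀ n m w → suc n * m + w ≡ n * m + (m + w)
      regroup = solve-∀
    y≡ : y ≡ 2 + r * h + e
    y≡ = +-cancelʳ-≡ (suc s * h) y _
           (trans (sym μ+w≡y+sh) (trans (cong (μK K +_) w≡e) (regroup (suc s) r e)))
      where
      regroup : ∀ s r e →
        2 + (s + r) * (4 + (s + r)) + e ≡ 2 + r * (4 + (s + r)) + e + s * (4 + (s + r))
      regroup = solve-∀

-- Beyond s = K + 1 the excess a μ + d γ would push y past μ.
offsets-high : ∀ K d a e y → 0 < K → e ≤ suc K + d → y < μK K →
               tK K + y ≡ a * μK K + (suc K + d) * γK K + e → Offsets K y
offsets-high K d a e y 0<K e≤ y<μ eq = by-excess a d e≤ y<μ y≡
  where
  excess : ℕ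
  excess = a * μK K + d * γK K
  y≡ : y ≡ K * (3 + K) + e + excess
  y≡ = +-cancelˡ-≡ (tK K) y _ (begin
    tK K + y                              ≡⟨ eq ⟩
    a * μK K + (suc K + d) * γK K + e     ≡⟨ regroup a (μK K) (suc K) d (γK K) e ⟩
    suc K * γK K + (e + excess)           ≡⟨ cong (_+ (e + excess)) ([1+K]*γK≡tK+K*[3+K] K) ⟩
    tK K + K * (3 + K) + (e + excess)     ≡⟨ regroup′ (tK K) (K * (3 + K)) e excess ⟩
    tK K + (K * (3 + K) + e + excess)     ∎)
    where
    open ≡-Reasoning
    regroup : ∀ a m k d g e → a * m + (k + d) * g + e ≡ k * g + (e + (a * m + d * g))
    regroup = solve-∀
    regroup′ : ∀ t q e x → t + q + (e + x) ≡ t + (q + e + x)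
    regroup′ = solve-∀
  by-excess : ∀ a d {y} → e ≤ suc K + d → y < μK K →
              y ≡ K * (3 + K) + e + (a * μK K + d * γK K) → Offsets K y
  by-excess zero zero e≤ _ refl =
    inj₂ (inj₂ (e , s≤s (subst (e ≤_) (+-identityʳ (suc K)) e≤) , +-identityʳ _))
  by-excess (suc a) d _ y<μ refl = ⊥-elim (<⇒≱ y<μ
    (≤-trans (≤-trans (m≤m+n _ (a * μK K)) (m≤m+n _ (d * γK K))) (m≤n+m _ (K * (3 + K) + e))))
  by-excess zero (suc d) _ y<μ refl = ⊥-elim (<⇒≱ y<μ
    (≤-trans (≤-trans (μK≤γK 0<K) (m≤m+n _ (d * γK K))) (m≤n+m _ (K * (3 + K) + e))))

generated⇒offsets : ∀ K y → 0 < K → y < μK K → Generated (μK K) (γK K) (tK K + y) → Offsets K y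
generated⇒offsets K y 0<K y<μ (a , s , e , e≤s , eq) with ≤-<-connex s K
... | inj₁ s≤K with m≤n⇒∃[o]m+o≡n s≤K
...   | r , refl =
  offsets-low s r a e y e≤s y<μ (Generated-level a s e (γK+[4+K]≡2*μK (s + r)) eq)
generated⇒offsets K y 0<K y<μ (a , s , e , e≤s , eq) | inj₂ K<s with m≤n⇒∃[o]m+o≡n K<s
...   | d , refl = offsets-high K d a e y 0<K e≤s y<μ eq

offsets⇒generated : ∀ K y → Offsets K y → Generated (μK K) (γK K) (tK K + y)
offsets⇒generated K _ (inj₁ refl) = K * 2 , 0 , 0 , z≤n , identity K
  where
  identity : ∀ K → K * 2 * (2 + K * (4 + K)) + 0
                 ≡ K * 2 * (2 + K * (4 + K)) + 0 * (K * (2 * K + 7)) + 0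
  identity = solve-∀
offsets⇒generated K _ (inj₂ (inj₁ (r , s , e , refl , _ , e≤s , refl))) =
  2 * r + 1 , s , e , e≤s , identity s r e
  where
  identity : ∀ s r e →
    (s + r) * 2 * (2 + (s + r) * (4 + (s + r))) + (2 + r * (4 + (s + r)) + e)
      ≡ (2 * r + 1) * (2 + (s + r) * (4 + (s + r))) + s * ((s + r) * (2 * (s + r) + 7)) + e
  identity = solve-∀
offsets⇒generated K _ (inj₂ (inj₂ (e , e<2+K , refl))) = 0 , suc K , e , ≤-pred e<2+K , identity K e
  where
  identity : ∀ K e → K * 2 * (2 + K * (4 + K)) + (K * (3 + K) + e)
                   ≡ 0 * (2 + K * (4 + K)) + suc K * (K * (2 * K + 7)) + e
  identity = solve-∀

-- Modulo μ the equation says s h ≡ e + 1, but e + 1 ≤ s + 1 < s h unless s = 0.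
tK-1∉Generated-low : ∀ s r a e x → e ≤ s → suc x ≡ tK (s + r) →
                     x + s * (4 + (s + r)) ≡ (a + 2 * s) * μK (s + r) + e → ⊥
tK-1∉Generated-low s r a e x e≤s 1+x≡t level =
  0≢1+n (trans (cong (_* h) (sym (s*[4+k]≤1+s⇒s≡0 (s + r) s s*h≤1+s))) s*h≡1+e)
  where
  open ≡-Reasoning
  h : ℕ
  h = 4 + (s + r)
  divided : (s + r) * 2 * μK (s + r) + s * h ≡ (a + 2 * s) * μK (s + r) + suc e
  divided = begin
    (s + r) * 2 * μK (s + r) + s * h   ≡⟨ cong (_+ s * h) 1+x≡t ⟨
    suc x + s * h                      ≡⟨ cong suc level ⟩
    suc ((a + 2 * s) * μK (s + r) + e) ≡⟨ +-suc _ e ⟨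
    (a + 2 * s) * μK (s + r) + suc e   ∎
  1+e<μ : suc e < μK (s + r)
  1+e<μ = ≤-<-trans (s≤s (≤-trans e≤s (m≤m+n s r))) (1+K<μK (s + r))
  s*h≡1+e : s * h ≡ suc e
  s*h≡1+e = remainder-unique ((s + r) * 2) (a + 2 * s) divided (s*[4+K]<μK s r) 1+e<μ
  s*h≤1+s : s * h ≤ suc s
  s*h≤1+s = ≤-trans (≤-reflexive s*h≡1+e) (s≤s e≤s)

tK-1∉Generated : ∀ K x → suc x ≡ tK K → ¬ Generated (μK K) (γK K) x
tK-1∉Generated K x 1+x≡t (a , s , e , e≤s , eq) with ≤-<-connex s K
... | inj₁ s≤K with m≤n⇒∃[o]m+o≡n s≤K
...   | r , refl =
  tK-1∉Generated-low s r a e x e≤s 1+x≡t (Generated-level a s e (γK+[4+K]≡2*μK (s + r)) eq)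
tK-1∉Generated K x 1+x≡t (a , s , e , e≤s , refl) | inj₂ K<s = <⇒≱ (≤-reflexive 1+x≡t) (begin
  tK K                     ≤⟨ m≤m+n (tK K) (K * (3 + K)) ⟩
  tK K + K * (3 + K)       ≡⟨ [1+K]*γK≡tK+K*[3+K] K ⟨
  suc K * γK K             ≤⟨ *-monoˡ-≤ (γK K) K<s ⟩
  s * γK K                 ≤⟨ m≤n+m _ (a * μK K) ⟩
  a * μK K + s * γK K      ≤⟨ m≤m+n _ e ⟩
  a * μK K + s * γK K + e  ∎)
  where open ≤-Reasoning

Offsets-< : ∀ {K y} → 0 < K → Offsets K y → y < μK K
Offsets-< _ (inj₁ refl) = s≤s z≤n
Offsets-< {suc j} _ (inj₂ (inj₁ stair)) =
  <-≤-trans (Stair-< stair) (≤-trans (m≤m+n _ (3 + j)) (≤-reflexive (identity j)))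
  where
  identity : ∀ j → 2 + j * (4 + suc j) + 2 + (3 + j) ≡ 2 + suc j * (4 + suc j)
  identity = solve-∀
Offsets-< {K} _ (inj₂ (inj₂ (e , e<2+K , refl))) =
  <-≤-trans (+-monoʳ-< (K * (3 + K)) e<2+K) (≤-reflexive (identity K))
  where
  identity : ∀ K → K * (3 + K) + (2 + K) ≡ 2 + K * (4 + K)
  identity = solve-∀

Stair<K*[3+K] : ∀ {K y} → 0 < K → Stair (4 + K) 2 K y → y < K * (3 + K)
Stair<K*[3+K] {suc j} _ stair = <-≤-trans (Stair-< stair) (≤-reflexive (identity j))
  where
  identity : ∀ j → 2 + j * (4 + suc j) + 2 ≡ suc j * (3 + suc j)
  identity = solve-∀

Offsets-card : ∀ {K} → 0 < K →
               ∃[ n ] (HasCard (Offsets K) n × 8 * n ≡ (K * 2) * (K * 2) + 10 * (K * 2) + 24)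
Offsets-card {K} 0<K with Stair-card (4 + K) 2 K (m<n+m K {4} (s≤s z≤n))
... | c , stair , 2c≡ =
  1 + (c + (2 + K)) ,
  HasCard-⊎ (HasCard-singleton 0)
    (HasCard-⊎ stair (HasCard-Interval (K * (3 + K)) (2 + K)) stair<top) 0<rest ,
  count
  where
  stair<top : ∀ {y z} → Stair (4 + K) 2 K y → Interval (K * (3 + K)) (2 + K) z → y < z
  stair<top st (e , _ , refl) = <-≤-trans (Stair<K*[3+K] 0<K st) (m≤m+n _ e)
  0<rest : ∀ {y z} → y ≡ 0 → Stair (4 + K) 2 K z ⊎ Interval (K * (3 + K)) (2 + K) z → y < z
  0<rest refl (inj₁ st) = ≤-trans (s≤s z≤n) (Stair-≥ st)
  0<rest refl (inj₂ (e , _ , refl)) = ≤-trans 0<K (≤-trans (m≤m*n K (3 + K)) (m≤m+n _ e))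
  count : 8 * (1 + (c + (2 + K))) ≡ (K * 2) * (K * 2) + 10 * (K * 2) + 24
  count = begin
    8 * (1 + (c + (2 + K)))               ≡⟨ identity₁ c K ⟩
    4 * (2 * c) + 8 * K + 24              ≡⟨ cong (λ u → 4 * u + 8 * K + 24) 2c≡ ⟩
    4 * (K * (K + 3)) + 8 * K + 24        ≡⟨ identity₂ K ⟩
    (K * 2) * (K * 2) + 10 * (K * 2) + 24 ∎
    where
    open ≡-Reasoning
    identity₁ : ∀ c K → 8 * (1 + (c + (2 + K))) ≡ 4 * (2 * c) + 8 * K + 24
    identity₁ = solve-∀
    identity₂ : ∀ K → 4 * (K * (K + 3)) + 8 * K + 24 ≡ (K * 2) * (K * 2) + 10 * (K * 2) + 24
    identity₂ = solve-∀

SK-≥μK : ∀ {K x} → 0 < K → 0 < x → SK K x → μK K ≤ x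
SK-≥μK 0<K 0<x Sx with Gen⇒Generated Sx
... | inj₁ t≤x = ≤-trans (μK≤tK 0<K) t≤x
... | inj₂ Gx  = Generated-≥ (μK≤γK 0<K) 0<x Gx

tK-1∉SK : ∀ K x → suc x ≡ tK K → ¬ SK K x
tK-1∉SK K x 1+x≡t Sx with Gen⇒Generated Sx
... | inj₁ t≤x = <⇒≱ (≤-reflexive 1+x≡t) t≤x
... | inj₂ Gx  = tK-1∉Generated K x 1+x≡t Gx

-- Below t + μ a decomposition has both summands below t, hence both in ⟨μ, γ, γ + 1⟩.
¬Offsets⇒MinGen : ∀ {K y} → 0 < K → y < μK K → ¬ Offsets K y → MinGen (SK K) (tK K + y)
¬Offsets⇒MinGen {K} {y} 0<K y<μ ¬offset =
  big∈ (m≤m+n _ y) , ≤-trans (s≤s z≤n) (≤-trans (μK≤tK 0<K) (m≤m+n _ y)) , indecomposable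
  where
  t+y<t+μ : tK K + y < tK K + μK K
  t+y<t+μ = +-monoʳ-< (tK K) y<μ
  indecomposable : ¬ (∃[ u ] ∃[ v ] (0 < u × 0 < v × SK K u × SK K v × u + v ≡ tK K + y))
  indecomposable (u , v , 0<u , 0<v , Su , Sv , u+v≡t+y) with Gen⇒Generated Su | Gen⇒Generated Sv
  ... | inj₁ t≤u | _        = <⇒≱ t+y<t+μ
    (≤-trans (+-mono-≤ t≤u (SK-≥μK 0<K 0<v Sv)) (≤-reflexive u+v≡t+y))
  ... | inj₂ _   | inj₁ t≤v = <⇒≱ t+y<t+μ
    (≤-trans (+-mono-≤ t≤v (SK-≥μK 0<K 0<u Su)) (≤-reflexive (trans (+-comm v u) u+v≡t+y)))
  ... | inj₂ Gu  | inj₂ Gv  = ¬offset (generated⇒offsets K y 0<K y<μ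
    (subst (Generated (μK K) (γK K)) u+v≡t+y (Generated-+ Gu Gv)))

InDq⇔Offsets : ∀ {K} → 0 < K → ∀ y → InDq (SK K) (tK K) (μK K) (tK K + y) ⇔ Offsets K y
InDq⇔Offsets {K} 0<K y = mk⇔ offset-of decomposable
  where
  -- Offsets K is finite, hence decidable: this turns ¬ MinGen into a positive conclusion.
  offset-of : InDq (SK K) (tK K) (μK K) (tK K + y) → Offsets K y
  offset-of (_ , t+y<t+μ , ¬mingen) with HasCard⇒Dec (proj₁ (proj₂ (Offsets-card 0<K))) y
  ... | yes offset = offset
  ... | no ¬offset =
    ⊥-elim (¬mingen (¬Offsets⇒MinGen 0<K (+-cancelˡ-< (tK K) y (μK K) t+y<t+μ) ¬offset))
  decomposable : Offsets K y → InDq (SK K) (tK K) (μK K) (tK K + y)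
  decomposable offset =
    m≤m+n (tK K) y ,
    +-monoʳ-< (tK K) (Offsets-< 0<K offset) ,
    Generated-¬MinGen (s≤s z≤n) (μK≤γK 0<K) (≤-trans (2+γK≤tK 0<K) (m≤m+n _ y))
      (offsets⇒generated K y offset)

Dq-card : ∀ {K} → 0 < K → ∀ c m → IsConductor (SK K) c → IsMultiplicity (SK K) m →
          ∃[ n ] (HasCard (InDq (SK K) c m) n × 8 * n ≡ (K * 2) * (K * 2) + 10 * (K * 2) + 24)
Dq-card {K} 0<K c m conductor multiplicity =
  let n , offsets , count = Offsets-card 0<K in
  n ,
  subst₂ (λ c m → HasCard (InDq (SK K) c m) n) (sym c≡tK) (sym m≡μK)
    (HasCard-shift {Offsets K} {InDq (SK K) (tK K) (μK K)} (tK K) offsets (λ _ → proj₁)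
      (InDq⇔Offsets 0<K)) ,
  count
  where
  c≡tK : c ≡ tK K
  c≡tK = IsConductor-unique {SK K} conductor (λ _ → big∈) (tK-1∉SK K)
  m≡μK : m ≡ μK K
  m≡μK = IsMultiplicity-unique {SK K} multiplicity (s≤s z≤n) (gen∈ (here refl)) (λ _ → SK-≥μK 0<K)

μ≡μK : ∀ K → μ (K * 2) ≡ μK K
μ≡μK K = begin
  K * 2 * (K * 2) / 4 + 2 * (K * 2) + 2 ≡⟨ cong (λ u → u / 4 + 2 * (K * 2) + 2) (square K) ⟩
  K * K * 4 / 4 + 2 * (K * 2) + 2       ≡⟨ cong (λ u → u + 2 * (K * 2) + 2) (m*n/n≡m (K * K) 4) ⟩
  K * K + 2 * (K * 2) + 2               ≡⟨ expand K ⟩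
  μK K                                  ∎
  where
  open ≡-Reasoning
  square : ∀ K → K * 2 * (K * 2) ≡ K * K * 4
  square = solve-∀
  expand : ∀ K → K * K + 2 * (K * 2) + 2 ≡ 2 + K * (4 + K)
  expand = solve-∀

γ≡γK : ∀ K → γ (K * 2) ≡ γK K
γ≡γK K = begin
  2 * μ (K * 2) ∸ (K * 2 / 2 + 4) ≡⟨ cong₂ (λ u v → 2 * u ∸ (v + 4)) (μ≡μK K) (m*n/n≡m K 2) ⟩
  2 * μK K ∸ (K + 4)              ≡⟨ cong (_∸ (K + 4)) 2μK≡γK+[K+4] ⟩
  γK K + (K + 4) ∸ (K + 4)        ≡⟨ m+n∸n≡m (γK K) (K + 4) ⟩
  γK K                            ∎
  where
  open ≡-Reasoning
  2μK≡γK+[K+4] : 2 * μK K ≡ γK K + (K + 4)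
  2μK≡γK+[K+4] = trans (sym (γK+[4+K]≡2*μK K)) (cong (γK K +_) (+-comm 4 K))

S≡SK : ∀ K → S (K * 2) ≡ SK K
S≡SK K = cong₂ (λ m g → Gen (m ∷ g ∷ suc g ∷ []) (K * 2 * m)) (μ≡μK K) (γ≡γK K)

corollary3p19 : (p : ℕ) → 0 < p → 2 ∣ p → (c m : ℕ) →
    IsConductor (S p) c → IsMultiplicity (S p) m →
    ∃[ n ] (HasCard (InDq (S p) c m) n × 8 * n ≡ p * p + 10 * p + 24)
corollary3p19 .(K * 2) 0<2K (divides K refl) c m rewrite S≡SK K = Dq-card (0<K K 0<2K) c m
  where
  0<K : ∀ K → 0 < K * 2 → 0 < K
  0<K (suc _) _ = s≤s z≤n
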